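{- Let $r\geqslant 3$ be an odd integer and let $\Gamma\cong\mathbb{Z}_{2r}\oplus\mathbb{Z}_8$. Then there exists a zero-sum $\Gamma$-magic rectangle set $\mathrm{MRS}_\Gamma(r,8;2)$, i.e. two $r\times 8$ arrays with entries in $\Gamma$ such that every element of $\Gamma$ appears exactly once and in exactly one of the two arrays, and every row sum and every column sum of each array equals $0_\Gamma$. -}

module Defs where

open import Data.Nat using (ℕ; _+_; _*_; NonZero)
open import Data.Nat.DivMod using (_mod_)
open import Data.Fin using (Fin; toℕ; zero)
open import Data.Product using (_×_; _,_; Σ)
open import Data.Vec.Functional using (foldr)
open import Relation.Binary.PropositionalEquality using (_≡_)
open import Function.Definitions using (Bijective)

addMod : (n : ℕ) .{{_ : NonZero n}} → Fin n → Fin n → Fin n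
addMod n a b = (toℕ a + toℕ b) mod n

Γ : ℕ → ℕ → Set
Γ m k = Fin m × Fin k

addΓ : (m k : ℕ) .{{_ : NonZero m}} .{{_ : NonZero k}} → Γ m k → Γ m k → Γ m k
addΓ m k (a , b) (c , d) = addMod m a c , addMod k b d

zeroΓ : (m k : ℕ) .{{_ : NonZero m}} .{{_ : NonZero k}} → Γ m k
zeroΓ m k = (0 mod m) , (0 mod k)

sumΓ : (m k : ℕ) .{{_ : NonZero m}} .{{_ : NonZero k}} → {n : ℕ} → (Fin n → Γ m k) → Γ m k
sumΓ m k f = foldr (addΓ m k) (zeroΓ m k) f

-- A zero-sum Γ-magic rectangle set MRS_Γ(a, b; c): c arrays of size a × b,
-- given as  A : Fin c → Fin a → Fin b → Γ  (array t, row i, column j),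
-- such that every element of Γ appears exactly once over all the arrays
-- (the map (t, i, j) ↦ A t i j is a bijection onto Γ), and every row sum and
-- every column sum of every array equals 0_Γ.
record ZeroSumMRS (m k : ℕ) .{{_ : NonZero m}} .{{_ : NonZero k}} (a b c : ℕ) : Set where
  field
    A       : Fin c → Fin a → Fin b → Γ m k
    bij     : Bijective {A = Fin c × Fin a × Fin b} _≡_ _≡_ (λ { (t , i , j) → A t i j })
    rowSum  : ∀ t i → sumΓ m k (λ j → A t i j) ≡ zeroΓ m k
    colSum  : ∀ t j → sumΓ m k (λ i → A t i j) ≡ zeroΓ m k

IsOdd : ℕ → Set
IsOdd r = Σ ℕ (λ k → r ≡ 1 + 2 * k)

module Submission where

-- Write r = 3 + 2m and M = 2r. Entries of Γ = ℤ_M ⊕ ℤ_8 are handled through lifts to ℕ × ℕ,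
-- with −(x, y) lifted as (M ∸ x, 8 ∸ y), and all row and column sums are computed in ℕ.
-- Each array consists of three block rows, cut from one fixed 2 × 3 × 8 pattern whose first
-- coordinates are 0, ±1, ±2 and r, followed by 2m pair rows: for every c = 3, …, r − 1 one
-- array contains the row (c,0) (c,1) (c,2) (c,3) −(c,4) … −(c,7) together with its negative.
-- A pair row sums to zero because 0+1+2+3 − (4+5+6+7) = −16 ≡ 0 (mod 8), and a row and its
-- negative cancel in every column; the block has zero row and column sums by a finite check
-- that does not depend on r. The first coordinates ±c (3 ≤ c < r) of the pair rows and the
-- six of the block exhaust ℤ_M, each occurring with every second coordinate, so the entries
-- cover Γ; as there are 2·r·8 = |Γ| of them, they are pairwise distinct.

open import Defs
open import Data.Nat using (ℕ; _*_; _≤_; NonZero)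
open import Data.Nat.Base using (zero; suc; _+_; _<_; _∸_; _<ᵇ_; s≤s; s≤s⁻¹; s<s⁻¹)
open import Data.Nat.Properties
open import Data.Nat.DivMod using (_%_; _mod_; m%n<n; %-distribˡ-+; m<n⇒m%n≡m; m*n%n≡0)
open import Data.Nat.Divisibility using (_∣_; divides; _∣?_; ∣-reflexive; ∣m∣n⇒∣m+n; n∣m⇒m%n≡0)
open import Data.Nat.Tactic.RingSolver using (solve-∀)
open import Data.Bool.Base using (Bool; true; false; not)
open import Data.Fin.Base using (Fin; zero; suc; toℕ; fromℕ<; punchOut; splitAt; join; _↑ˡ_; _↑ʳ_)
open import Data.Fin.Patterns using (0F; 1F; 2F; 3F; 4F; 5F)
open import Data.Fin.Properties
  using (toℕ-fromℕ<; toℕ-injective; toℕ<n; punchOut-injective; injective⇒≤; any?; all?; join-splitAt; *↔×)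
  renaming (_≟_ to _≟ᶠ_)
open import Data.Product using (_×_; _,_; ∃; proj₁; proj₂)
open import Data.Product.Function.NonDependent.Propositional using (_×-↔_)
open import Data.Sum using (inj₁; inj₂)
open import Data.Sum.Properties using ([,]-map)
open import Data.Vec.Functional using (Vector; _++_; _∷_; [])
open import Data.Vec.Functional.Properties using (lookup-++ˡ; lookup-++ʳ)
open import Data.Vec.Functional.Relation.Unary.All.Properties using (++⁺)
open import Algebra.Properties.CommutativeMonoid.Sum +-0-commutativeMonoid using (sum; sum-cong-≗; ∑-distrib-+)
open import Algebra.Properties.Semiring.Sum +-*-semiring using (*-distribʳ-sum)
open import Relation.Nullary using (Dec; yes; no; contradiction)
open import Relation.Nullary.Decidable using (from-yes; _×-dec_)
open import Relation.Binary.PropositionalEquality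
open import Function.Base using (_∘_; _$_)
open import Function.Bundles using (_↔_; Inverse)
open import Function.Definitions using (Injective; StrictlySurjective; Bijective)
open import Function.Consequences.Propositional using (strictlySurjective⇒surjective)
open import Function.Properties.Inverse using (↔-sym; ↔-trans; ↔-refl)

sum-++ : ∀ {A : Set} {a b} (g : A → ℕ) (xs : Vector A a) (ys : Vector A b) →
         sum (g ∘ (xs ++ ys)) ≡ sum (g ∘ xs) + sum (g ∘ ys)
sum-++ {a = zero}  g xs ys = refl
sum-++ {a = suc a} g xs ys = begin
  g (xs 0F) + sum (g ∘ (xs ++ ys) ∘ suc)
    ≡⟨ cong (g (xs 0F) +_) (sum-cong-≗ (cong g ∘ [,]-map ∘ splitAt a)) ⟩
  g (xs 0F) + sum (g ∘ ((xs ∘ suc) ++ ys))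
    ≡⟨ cong (g (xs 0F) +_) (sum-++ g (xs ∘ suc) ys) ⟩
  g (xs 0F) + (sum (g ∘ xs ∘ suc) + sum (g ∘ ys))
    ≡⟨ +-assoc (g (xs 0F)) _ _ ⟨
  sum (g ∘ xs) + sum (g ∘ ys)
    ∎
  where open ≡-Reasoning

∣-sum : ∀ {d n} (f : Vector ℕ n) → (∀ i → d ∣ f i) → d ∣ sum f
∣-sum {n = zero}  f d∣f = divides 0 refl
∣-sum {n = suc n} f d∣f = ∣m∣n⇒∣m+n (d∣f 0F) (∣-sum (f ∘ suc) (d∣f ∘ suc))

∣-sum-++ : ∀ {A : Set} {a b d} (g : A → ℕ) (xs : Vector A a) (ys : Vector A b) →
           d ∣ sum (g ∘ xs) → d ∣ sum (g ∘ ys) → d ∣ sum (g ∘ (xs ++ ys))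
∣-sum-++ {d = d} g xs ys d∣xs d∣ys = subst (d ∣_) (sym (sum-++ g xs ys)) (∣m∣n⇒∣m+n d∣xs d∣ys)

∣-sum-++-pairwise : ∀ {A : Set} {a d} (g : A → ℕ) (xs ys : Vector A a) →
                    (∀ p → d ∣ g (xs p) + g (ys p)) → d ∣ sum (g ∘ (xs ++ ys))
∣-sum-++-pairwise {d = d} g xs ys d∣pairs =
  subst (d ∣_) (trans (∑-distrib-+ (g ∘ xs) (g ∘ ys)) (sym (sum-++ g xs ys)))
    (∣-sum (λ p → g (xs p) + g (ys p)) d∣pairs)

toℕ-mod : ∀ x n .{{_ : NonZero n}} → toℕ (x mod n) ≡ x % n
toℕ-mod x n = toℕ-fromℕ< (m%n<n x n)

mod-toℕ : ∀ {n} .{{_ : NonZero n}} (i : Fin n) → toℕ i mod n ≡ i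
mod-toℕ {n} i = toℕ-injective (trans (toℕ-mod (toℕ i) n) (m<n⇒m%n≡m (toℕ<n i)))

addMod-mod : ∀ n .{{_ : NonZero n}} x y → addMod n (x mod n) (y mod n) ≡ (x + y) mod n
addMod-mod n x y = toℕ-injective (begin
  toℕ (addMod n (x mod n) (y mod n))  ≡⟨ toℕ-mod _ n ⟩
  (toℕ (x mod n) + toℕ (y mod n)) % n ≡⟨ cong₂ (λ u v → (u + v) % n) (toℕ-mod x n) (toℕ-mod y n) ⟩
  (x % n + y % n) % n                 ≡⟨ %-distribˡ-+ x y n ⟨
  (x + y) % n                         ≡⟨ toℕ-mod (x + y) n ⟨
  toℕ ((x + y) mod n)                 ∎)
  where open ≡-Reasoning

∣⇒mod≡0 : ∀ {n x} .{{_ : NonZero n}} → n ∣ x → x mod n ≡ 0 mod n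
∣⇒mod≡0 {n} {x} n∣x = toℕ-injective (begin
  toℕ (x mod n) ≡⟨ toℕ-mod x n ⟩
  x % n         ≡⟨ n∣m⇒m%n≡0 x n n∣x ⟩
  0             ≡⟨ m*n%n≡0 0 n ⟨
  0 % n         ≡⟨ toℕ-mod 0 n ⟨
  toℕ (0 mod n) ∎)
  where open ≡-Reasoning

Fin-injective⇒surjective : ∀ {n} {g : Fin n → Fin n} → Injective _≡_ _≡_ g →
                           StrictlySurjective _≡_ g
Fin-injective⇒surjective {suc n} {g} g-inj x with any? (λ y → g y ≟ᶠ x)
... | yes hit = hit
... | no miss = contradiction (injective⇒≤ h-inj) 1+n≰n
  where
  x≢g : ∀ y → x ≢ g y
  x≢g y x≡gy = miss (y , sym x≡gy)

  h : Fin (suc n) → Fin n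
  h y = punchOut (x≢g y)

  h-inj : Injective _≡_ _≡_ h
  h-inj {y₁} {y₂} = g-inj ∘ punchOut-injective (x≢g y₁) (x≢g y₂)

Fin-surjective⇒injective : ∀ {n} {f : Fin n → Fin n} → StrictlySurjective _≡_ f →
                           Injective _≡_ _≡_ f
Fin-surjective⇒injective {f = f} f-surj = f-inj
  where
  g : Fin _ → Fin _
  g = proj₁ ∘ f-surj

  f∘g : ∀ y → f (g y) ≡ y
  f∘g = proj₂ ∘ f-surj

  g-inj : Injective _≡_ _≡_ g
  g-inj {y₁} {y₂} gy₁≡gy₂ = trans (sym (f∘g y₁)) (trans (cong f gy₁≡gy₂) (f∘g y₂))

  f-inj : Injective _≡_ _≡_ f
  f-inj {x₁} {x₂} fx₁≡fx₂
    with y₁ , refl ← Fin-injective⇒surjective g-inj x₁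
       | y₂ , refl ← Fin-injective⇒surjective g-inj x₂ = cong g (begin
    y₁       ≡⟨ f∘g y₁ ⟨
    f (g y₁) ≡⟨ fx₁≡fx₂ ⟩
    f (g y₂) ≡⟨ f∘g y₂ ⟩
    y₂       ∎)
    where open ≡-Reasoning

surjective⇒bijective : ∀ {n} {A B : Set} → A ↔ Fin n → B ↔ Fin n → (f : A → B) →
                       StrictlySurjective _≡_ f → Bijective _≡_ _≡_ f
surjective⇒bijective A↔ B↔ f f-surj = f-inj , strictlySurjective⇒surjective f-surj
  where
  module A = Inverse A↔
  module B = Inverse B↔

  h : Fin _ → Fin _
  h = B.to ∘ f ∘ A.from

  h∘A-to : ∀ x → h (A.to x) ≡ B.to (f x)
  h∘A-to x = cong (B.to ∘ f) (A.strictlyInverseʳ x)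

  h-surj : StrictlySurjective _≡_ h
  h-surj y = let x , fx≡y = f-surj (B.from y)
             in A.to x , trans (h∘A-to x) (trans (cong B.to fx≡y) (B.strictlyInverseˡ y))

  A-to-inj : Injective _≡_ _≡_ A.to
  A-to-inj {x₁} {x₂} e = trans (sym (A.strictlyInverseʳ x₁)) (trans (cong A.from e) (A.strictlyInverseʳ x₂))

  f-inj : Injective _≡_ _≡_ f
  f-inj {x₁} {x₂} fx₁≡fx₂ = A-to-inj (Fin-surjective⇒injective h-surj (begin
    h (A.to x₁) ≡⟨ h∘A-to x₁ ⟩
    B.to (f x₁) ≡⟨ cong B.to fx₁≡fx₂ ⟩
    B.to (f x₂) ≡⟨ h∘A-to x₂ ⟨
    h (A.to x₂) ∎))
    where open ≡-Reasoning

module Lift (m k : ℕ) .{{_ : NonZero m}} .{{_ : NonZero k}} where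

  reduce : ℕ × ℕ → Γ m k
  reduce (x , y) = x mod m , y mod k

  ZeroSum : ∀ {n} → Vector (ℕ × ℕ) n → Set
  ZeroSum f = m ∣ sum (proj₁ ∘ f) × k ∣ sum (proj₂ ∘ f)

  sumΓ-reduce : ∀ {n} (f : Vector (ℕ × ℕ) n) →
                sumΓ m k (reduce ∘ f) ≡ reduce (sum (proj₁ ∘ f) , sum (proj₂ ∘ f))
  sumΓ-reduce {zero}  f = refl
  sumΓ-reduce {suc n} f = begin
    addΓ m k (reduce (f 0F)) (sumΓ m k (reduce ∘ f ∘ suc))
      ≡⟨ cong (addΓ m k (reduce (f 0F))) (sumΓ-reduce (f ∘ suc)) ⟩
    addΓ m k (reduce (f 0F)) (reduce (sum (proj₁ ∘ f ∘ suc) , sum (proj₂ ∘ f ∘ suc)))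
      ≡⟨ cong₂ _,_ (addMod-mod m _ _) (addMod-mod k _ _) ⟩
    reduce (sum (proj₁ ∘ f) , sum (proj₂ ∘ f))
      ∎
    where open ≡-Reasoning

  sumΓ-reduce-zeroSum : ∀ {n} (f : Vector (ℕ × ℕ) n) → ZeroSum f → sumΓ m k (reduce ∘ f) ≡ zeroΓ m k
  sumΓ-reduce-zeroSum f (m∣xs , k∣ys) = trans (sumΓ-reduce f) (cong₂ _,_ (∣⇒mod≡0 m∣xs) (∣⇒mod≡0 k∣ys))

  zeroSumMRS-fromLift : ∀ {a b c} (E : Fin c → Fin a → Fin b → ℕ × ℕ) → c * (a * b) ≡ m * k →
    (∀ t i → ZeroSum (E t i)) → (∀ t j → ZeroSum (λ i → E t i j)) →
    (∀ γ → ∃ λ t → ∃ λ i → ∃ λ j → reduce (E t i j) ≡ γ) →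
    ZeroSumMRS m k a b c
  zeroSumMRS-fromLift {a} {b} {c} E count rows cols covers = record
    { A      = λ t i j → reduce (E t i j)
    ; bij    = surjective⇒bijective cells↔ (↔-sym *↔×) _ image-surj
    ; rowSum = λ t i → sumΓ-reduce-zeroSum (E t i) (rows t i)
    ; colSum = λ t j → sumΓ-reduce-zeroSum (λ i → E t i j) (cols t j)
    }
    where
    cells↔ : (Fin c × Fin a × Fin b) ↔ Fin (m * k)
    cells↔ = subst (λ n → (Fin c × Fin a × Fin b) ↔ Fin n) count
               (↔-sym (↔-trans (*↔× {c}) (↔-refl ×-↔ *↔× {a} {b})))

    image-surj : StrictlySurjective _≡_ (λ { (t , i , j) → reduce (E t i j) })
    image-surj γ = let t , i , j , eq = covers γ in (t , i , j) , eq

signed : ℕ → Bool → ℕ → ℕ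
signed n true  v = v
signed n false v = n ∸ v

signed-cancel : ∀ {n v} σ → v ≤ n → signed n σ v + signed n (not σ) v ≡ n
signed-cancel true  v≤n = m+[n∸m]≡n v≤n
signed-cancel false v≤n = m∸n+n≡m v≤n

sign : Fin 2 → Fin 8 → Bool
sign 0F j = toℕ j <ᵇ 4
sign 1F j = not (toℕ j <ᵇ 4)

sign-surjective : ∀ j σ → ∃ λ s → sign s j ≡ σ
sign-surjective j σ with toℕ j <ᵇ 4 in j<4 | σ
... | true  | true  = 0F , j<4
... | true  | false = 1F , cong not j<4
... | false | true  = 1F , cong not j<4
... | false | false = 0F , j<4

signedRow-∣ : ∀ n s v → v ≤ n → n ∣ sum (λ j → signed n (sign s j) v)
signedRow-∣ n s v v≤n = divides 4 (trans (row-sum s) (cong (4 *_) (signed-cancel (sign s 0F) v≤n)))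
  where
  four-and-four : ∀ a b → a + (a + (a + (a + (b + (b + (b + (b + 0))))))) ≡ 4 * (a + b)
  four-and-four = solve-∀

  row-sum : ∀ s → sum (λ j → signed n (sign s j) v) ≡ 4 * (signed n (sign s 0F) v + signed n (not (sign s 0F)) v)
  row-sum 0F = four-and-four v (n ∸ v)
  row-sum 1F = four-and-four (n ∸ v) v

signedIndexRow-∣ : ∀ s → 8 ∣ sum (λ j → signed 8 (sign s j) (toℕ j))
signedIndexRow-∣ 0F = divides 2 refl
signedIndexRow-∣ 1F = divides 6 refl

-- A first coordinate in the block is stored as its rank a in 0 < 1 < 2 < r < 2r − 2 < 2r − 1.
-- The coordinate itself is a + weight a · (r − 3), so ranks with Σ a = 3 w for an even
-- w = Σ weight a give the multiple (w / 2) · 2r of 2r whatever r is.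
weight : ℕ → ℕ
weight 3 = 1
weight 4 = 2
weight 5 = 2
weight _ = 0

Balanced : ∀ {n} → Vector ℕ n → Set
Balanced as = sum as ≡ 3 * sum (weight ∘ as) × 2 ∣ sum (weight ∘ as)

balanced? : ∀ {n} (as : Vector ℕ n) → Dec (Balanced as)
balanced? as = sum as ≟ 3 * sum (weight ∘ as) ×-dec 2 ∣? sum (weight ∘ as)

rank : Fin 3 → Fin 8 → ℕ
rank = (3 ∷ 3 ∷ 2 ∷ 4 ∷ 1 ∷ 5 ∷ 4 ∷ 2 ∷ [])
     ∷ (3 ∷ 3 ∷ 4 ∷ 2 ∷ 1 ∷ 5 ∷ 1 ∷ 5 ∷ [])
     ∷ (0 ∷ 0 ∷ 0 ∷ 0 ∷ 4 ∷ 2 ∷ 1 ∷ 5 ∷ [])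
     ∷ []

blockY : Fin 2 → Fin 3 → Fin 8 → ℕ
blockY = ( (4 ∷ 2 ∷ 6 ∷ 6 ∷ 7 ∷ 6 ∷ 5 ∷ 4 ∷ [])
         ∷ (7 ∷ 5 ∷ 3 ∷ 7 ∷ 5 ∷ 0 ∷ 2 ∷ 3 ∷ [])
         ∷ (5 ∷ 1 ∷ 7 ∷ 3 ∷ 4 ∷ 2 ∷ 1 ∷ 1 ∷ [])
         ∷ [])
       ∷ ( (0 ∷ 3 ∷ 0 ∷ 7 ∷ 0 ∷ 4 ∷ 1 ∷ 1 ∷ [])
         ∷ (6 ∷ 1 ∷ 0 ∷ 3 ∷ 6 ∷ 7 ∷ 4 ∷ 5 ∷ [])
         ∷ (2 ∷ 4 ∷ 0 ∷ 6 ∷ 2 ∷ 5 ∷ 3 ∷ 2 ∷ [])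
         ∷ [])
       ∷ []

rank-rows-balanced : ∀ i → Balanced (rank i)
rank-rows-balanced = from-yes (all? (balanced? ∘ rank))

rank-columns-balanced : ∀ j → Balanced (λ i → rank i j)
rank-columns-balanced = from-yes (all? λ j → balanced? (λ i → rank i j))

blockY-rows-∣ : ∀ t i → 8 ∣ sum (blockY t i)
blockY-rows-∣ = from-yes (all? λ t → all? λ i → 8 ∣? sum (blockY t i))

blockY-columns-∣ : ∀ t j → 8 ∣ sum (λ i → blockY t i j)
blockY-columns-∣ = from-yes (all? λ t → all? λ j → 8 ∣? sum (λ i → blockY t i j))

-- Opaque so that using it does not re-run the 48 × 48 search.
opaque
  block-covers : ∀ (a : Fin 6) (y : Fin 8) →
                 ∃ λ t → ∃ λ i → ∃ λ j → rank i j ≡ toℕ a × blockY t i j ≡ toℕ y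
  block-covers = from-yes (all? λ (a : Fin 6) → all? λ (y : Fin 8) →
                   any? λ t → any? λ i → any? λ j → rank i j ≟ toℕ a ×-dec blockY t i j ≟ toℕ y)

negation-covers : ∀ (y : Fin 8) → ∃ λ j → (8 ∸ toℕ j) mod 8 ≡ y
negation-covers = from-yes (all? λ (y : Fin 8) → any? λ (j : Fin 8) → (8 ∸ toℕ j) mod 8 ≟ᶠ y)

half : ∀ {m} → Fin 2 → Fin m → Fin (m + m)
half {m} 0F p = p ↑ˡ m
half {m} 1F p = m ↑ʳ p

half-surjective : ∀ {m} (u : Fin (m + m)) → ∃ λ t → ∃ λ p → half {m} t p ≡ u
half-surjective {m} u with splitAt m u in split≡
... | inj₁ p = 0F , p , trans (cong (join m m) (sym split≡)) (join-splitAt m m u)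
... | inj₂ p = 1F , p , trans (cong (join m m) (sym split≡)) (join-splitAt m m u)

module Construction (m : ℕ) where

  D r M : ℕ
  D = m + m
  r = 3 + D
  M = 2 * r

  open Lift M 8

  blockValue : ℕ → ℕ
  blockValue 3 = r
  blockValue 4 = M ∸ 2
  blockValue 5 = M ∸ 1
  blockValue a = a

  blockValue-affine : ∀ a → blockValue a ≡ a + weight a * D
  blockValue-affine 0 = refl
  blockValue-affine 1 = refl
  blockValue-affine 2 = refl
  blockValue-affine 3 = cong (3 +_) (sym (+-identityʳ D))
  blockValue-affine 4 = cong (_∸ 2) (*-distribˡ-+ 2 3 D)
  blockValue-affine 5 = cong (_∸ 1) (*-distribˡ-+ 2 3 D)
  blockValue-affine (suc (suc (suc (suc (suc (suc a)))))) = sym (+-identityʳ _)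

  balanced⇒∣ : ∀ {n} (as : Vector ℕ n) → Balanced as → M ∣ sum (blockValue ∘ as)
  balanced⇒∣ as (Σa≡3w , divides q w≡q*2) = divides q (begin
    sum (blockValue ∘ as)                   ≡⟨ sum-cong-≗ (blockValue-affine ∘ as) ⟩
    sum (λ i → as i + weight (as i) * D)    ≡⟨ ∑-distrib-+ as _ ⟩
    sum as + sum (λ i → weight (as i) * D)  ≡⟨ cong (sum as +_) (*-distribʳ-sum D (weight ∘ as)) ⟨
    sum as + w * D                          ≡⟨ cong (_+ w * D) Σa≡3w ⟩
    3 * w + w * D                           ≡⟨ cong (λ w → 3 * w + w * D) w≡q*2 ⟩
    3 * (q * 2) + q * 2 * D                 ≡⟨ even-weight q D ⟩
    q * M                                   ∎)
    where
    open ≡-Reasoning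
    w = sum (weight ∘ as)
    even-weight : ∀ q d → 3 * (q * 2) + q * 2 * d ≡ q * (2 * (3 + d))
    even-weight = solve-∀

  value : Fin 2 → Fin m → ℕ
  value t p = 3 + toℕ (half t p)

  value≤M : ∀ t p → value t p ≤ M
  value≤M t p = ≤-trans (<⇒≤ (+-monoʳ-< 3 (toℕ<n (half t p)))) (m≤m+n r (r + 0))

  blockRows : Fin 2 → Fin 3 → Fin 8 → ℕ × ℕ
  blockRows t i j = blockValue (rank i j) , blockY t i j

  pairRow : Fin 2 → Fin 2 → Fin m → Fin 8 → ℕ × ℕ
  pairRow t s p j = signed M (sign s j) (value t p) , signed 8 (sign s j) (toℕ j)

  pairRows : Fin 2 → Fin D → Fin 8 → ℕ × ℕ
  pairRows t = pairRow t 0F ++ pairRow t 1F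

  rows : Fin 2 → Fin r → Fin 8 → ℕ × ℕ
  rows t = blockRows t ++ pairRows t

  pairRows-half : ∀ t s p → pairRows t (half s p) ≡ pairRow t s p
  pairRows-half t 0F p = lookup-++ˡ (pairRow t 0F) (pairRow t 1F) p
  pairRows-half t 1F p = lookup-++ʳ (pairRow t 0F) (pairRow t 1F) p

  rows-zeroSum : ∀ t i → ZeroSum (rows t i)
  rows-zeroSum t = ++⁺ ZeroSum block-row (++⁺ ZeroSum (pair-row 0F) (pair-row 1F))
    where
    block-row : ∀ i → ZeroSum (blockRows t i)
    block-row i = balanced⇒∣ (rank i) (rank-rows-balanced i) , blockY-rows-∣ t i

    pair-row : ∀ s p → ZeroSum (pairRow t s p)
    pair-row s p = signedRow-∣ M s (value t p) (value≤M t p) , signedIndexRow-∣ s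

  columns-zeroSum : ∀ t j → ZeroSum (λ i → rows t i j)
  columns-zeroSum t j =
      ∣-sum-++ (λ row → proj₁ (row j)) (blockRows t) (pairRows t)
        (balanced⇒∣ (λ i → rank i j) (rank-columns-balanced j))
        (∣-sum-++-pairwise (λ row → proj₁ (row j)) (pairRow t 0F) (pairRow t 1F)
          (λ p → ∣-reflexive (sym (signed-cancel (sign 0F j) (value≤M t p)))))
    , ∣-sum-++ (λ row → proj₂ (row j)) (blockRows t) (pairRows t)
        (blockY-columns-∣ t j)
        (∣-sum-++-pairwise (λ row → proj₂ (row j)) (pairRow t 0F) (pairRow t 1F)
          (λ p → ∣-reflexive (sym (signed-cancel (sign 0F j) (<⇒≤ (toℕ<n j))))))

  data XView : ℕ → Set where
    block : (a : Fin 6) → XView (blockValue (toℕ a))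
    plus  : (u : Fin D) → XView (3 + toℕ u)
    minus : (u : Fin D) → XView (M ∸ (3 + toℕ u))

  xView-≤r : ∀ c → c ≤ r → XView c
  xView-≤r 0 _ = block 0F
  xView-≤r 1 _ = block 1F
  xView-≤r 2 _ = block 2F
  xView-≤r (suc (suc (suc k))) c≤r with m≤n⇒m<n∨m≡n (s≤s⁻¹ (s≤s⁻¹ (s≤s⁻¹ c≤r)))
  ... | inj₁ k<D  = subst (λ v → XView (3 + v)) (toℕ-fromℕ< k<D) (plus (fromℕ< k<D))
  ... | inj₂ refl = block 3F

  xView-M∸ : ∀ c → 0 < c → c < r → XView (M ∸ c)
  xView-M∸ 1 _ _ = block 5F
  xView-M∸ 2 _ _ = block 4F
  xView-M∸ (suc (suc (suc k))) _ c<r =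
    subst (λ v → XView (M ∸ (3 + v))) (toℕ-fromℕ< k<D) (minus (fromℕ< k<D))
    where
    k<D : k < D
    k<D = s<s⁻¹ (s<s⁻¹ (s<s⁻¹ c<r))

  xView : ∀ n → n < M → XView n
  xView n n<M with n ≤? r
  ... | yes n≤r = xView-≤r n n≤r
  ... | no  n≰r = subst XView (m∸[m∸n]≡n (<⇒≤ n<M)) (xView-M∸ (M ∸ n) (m<n⇒0<n∸m n<M) M∸n<r)
    where
    M∸r≡r : M ∸ r ≡ r
    M∸r≡r = trans (m+n∸m≡n r (r + 0)) (+-identityʳ r)

    M∸n<r : M ∸ n < r
    M∸n<r = subst (M ∸ n <_) M∸r≡r (∸-monoʳ-< (≰⇒> n≰r) (<⇒≤ n<M))

  Covered : ℕ × ℕ → Set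
  Covered e = ∃ λ t → ∃ λ i → ∃ λ j → rows t i j ≡ e

  block-cell : ∀ a y → Covered (blockValue (toℕ a) , toℕ y)
  block-cell a y =
    let t , i , j , rank≡a , blockY≡y = block-covers a y
    in t , i ↑ˡ D , j ,
       trans (cong (_$ j) (lookup-++ˡ (blockRows t) (pairRows t) i))
             (cong₂ _,_ (cong blockValue rank≡a) blockY≡y)

  pair-cell : ∀ u σ j → Covered (signed M σ (3 + toℕ u) , signed 8 σ (toℕ j))
  pair-cell u σ j =
    let t , p , half≡u = half-surjective u
        s , sign≡σ     = sign-surjective j σ
    in t , 3 ↑ʳ half s p , j ,
       trans (cong (_$ j) (pairRows-half t s p))
             (cong₂ (λ τ v → signed M τ (3 + toℕ v) , signed 8 τ (toℕ j)) sign≡σ half≡u)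

  reduce-covers : ∀ {n} → XView n → ∀ y → ∃ λ t → ∃ λ i → ∃ λ j → reduce (rows t i j) ≡ (n mod M , y)
  reduce-covers (block a) y =
    let t , i , j , eq = block-cell a y
    in t , i , j , trans (cong reduce eq) (cong (_ ,_) (mod-toℕ y))
  reduce-covers (plus u) y =
    let t , i , j , eq = pair-cell u true y
    in t , i , j , trans (cong reduce eq) (cong (_ ,_) (mod-toℕ y))
  reduce-covers (minus u) y =
    let j , -j≡y       = negation-covers y
        t , i , j′ , eq = pair-cell u false j
    in t , i , j′ , trans (cong reduce eq) (cong (_ ,_) -j≡y)

  zeroSumMRS : ZeroSumMRS M 8 r 8 2
  zeroSumMRS = zeroSumMRS-fromLift rows (sym (*-assoc 2 r 8)) rows-zeroSum columns-zeroSum covers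
    where
    covers : ∀ γ → ∃ λ t → ∃ λ i → ∃ λ j → reduce (rows t i j) ≡ γ
    covers (x , y) =
      let t , i , j , eq = reduce-covers (xView (toℕ x) (toℕ<n x)) y
      in t , i , j , trans eq (cong (_, y) (mod-toℕ x))

zeroSumMRS-3+m+m : ∀ r m → r ≡ 3 + (m + m) → .{{_ : NonZero (2 * r)}} → ZeroSumMRS (2 * r) 8 r 8 2
zeroSumMRS-3+m+m _ m refl = Construction.zeroSumMRS m

lemma4p8 : (r : ℕ) → 3 ≤ r → IsOdd r → .{{_ : NonZero (2 * r)}} →
    ZeroSumMRS (2 * r) 8 r 8 2
lemma4p8 _ (s≤s (s≤s (s≤s _))) (zero , ())
lemma4p8 r _ (suc m , r≡1+2[1+m]) = zeroSumMRS-3+m+m r m (trans r≡1+2[1+m] (1+2[1+m]≡3+[m+m] m))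
  where
  1+2[1+m]≡3+[m+m] : ∀ m → 1 + 2 * suc m ≡ 3 + (m + m)
  1+2[1+m]≡3+[m+m] = solve-∀
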